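{- For every $n \geq 1$, $\mathsf{Tr}(n+1) = \{u0 : u \in \mathsf{Tr}(n)\} \cup \{u2 : u \in \mathsf{Tr}(n)\} \cup \{1w1 : w \in \{1,2\}^{n-1}\}$, and $(\mathsf{Tr}(n+1),\preccurlyeq)$ is this set with the componentwise order.
   Context: For $n\ge1$, $\mathsf{Tr}(n)$ is the set of words $u = u_1\cdots u_n$ over $\{0,1,2\}$ with $u_1 \neq 2$ and no indices $i<j$ with $u_i=0$, $u_j=1$, ordered componentwise ($u\preccurlyeq v$ iff $u_i\le v_i$ for all $i$). -}

module Defs where

open import Data.Nat using (ℕ; zero; suc)
open import Data.Fin using (Fin; zero; suc)
open import Data.Vec using (Vec; []; _∷_; _∷ʳ_; lookup)
open import Data.Product using (Σ; _×_; ∃)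
open import Data.Sum using (_⊎_)
open import Data.Empty using (⊥)
open import Relation.Binary.PropositionalEquality using (_≡_)
open import Relation.Nullary using (¬_)

data Letter : Set where
  l0 l1 l2 : Letter

data _≤L_ : Letter → Letter → Set where
  0≤0 : l0 ≤L l0
  0≤1 : l0 ≤L l1
  0≤2 : l0 ≤L l2
  1≤1 : l1 ≤L l1
  1≤2 : l1 ≤L l2
  2≤2 : l2 ≤L l2

Word : ℕ → Set
Word n = Vec Letter n

_≼_ : ∀ {n} → Word n → Word n → Set
_≼_ {n} u v = (i : Fin n) → lookup u i ≤L lookup v i

record Tr (n : ℕ) (u : Word n) : Set where
  field
    firstNot2 : (i : Fin n) → Data.Fin.toℕ i ≡ 0 → ¬ (lookup u i ≡ l2)
    no01 : (i j : Fin n) → Data.Fin._<_ i j → lookup u i ≡ l0 → ¬ (lookup u j ≡ l1)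

OneTwo : ∀ {m} → Word m → Set
OneTwo {m} w = (i : Fin m) → ¬ (lookup w i ≡ l0)

module Submission where

-- Every word of length n+1 is uniquely u ∷ʳ a (its prefix u of
-- length n followed by its last letter a), and positions of u ∷ʳ a are
-- either inject₁ i (a position i of u) or the new last position fromℕ n.
--   * Componentwise order: splitting the positions this way shows at once
--     that u ∷ʳ a ≼ u′ ∷ʳ b iff u ≼ u′ and a ≤ b.
--   * Snoc characterisation of Tr (lemma Tr-∷ʳ): for a nonempty prefix u,
--     u ∷ʳ a ∈ Tr iff u ∈ Tr and, if a = 1, u contains no 0.  Indeed the
--     first letter lies in u, a pattern 0…1 lies inside u or ends at a, and
--     the last position is never the left end of such a pattern.
--   * A word over {1,2} is in Tr iff it starts with 1 (lemma Tr-over12).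
-- The theorem follows by a case split on the last letter: a = 0 and a = 2
-- give the first two families; for a = 1 the prefix is a word over {1,2}
-- in Tr, hence of the form 1w with w over {1,2}.

open import Defs
open import Data.Nat using (ℕ; suc; s≤s; z≤n)
open import Data.Fin using (Fin; zero; suc; inject₁; fromℕ; toℕ; _<_)
open import Data.Fin.Properties using (toℕ-inject₁; <-asym; <-irrefl)
open import Data.Fin.Relation.Unary.Top using (view; ‵fromℕ; ‵inject₁)
open import Data.Vec using (Vec; []; _∷_; _∷ʳ_; lookup; initLast)
open import Data.Product using (Σ; _×_; _,_; proj₁)
open import Data.Sum using (_⊎_; inj₁; inj₂)
open import Data.Empty using (⊥-elim)
open import Relation.Nullary using (¬_)
open import Relation.Binary.PropositionalEquality
  using (_≡_; refl; sym; trans; subst₂)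
open import Function.Bundles using (_⇔_; mk⇔; module Equivalence)
import Data.Nat as ℕ

lookup-∷ʳ-inject₁ : ∀ {A : Set} {n} (u : Vec A n) a (i : Fin n)
  → lookup (u ∷ʳ a) (inject₁ i) ≡ lookup u i
lookup-∷ʳ-inject₁ (x ∷ u) a zero    = refl
lookup-∷ʳ-inject₁ (x ∷ u) a (suc i) = lookup-∷ʳ-inject₁ u a i

lookup-∷ʳ-fromℕ : ∀ {A : Set} {n} (u : Vec A n) a → lookup (u ∷ʳ a) (fromℕ n) ≡ a
lookup-∷ʳ-fromℕ []      a = refl
lookup-∷ʳ-fromℕ (x ∷ u) a = lookup-∷ʳ-fromℕ u a

inject₁-<⇔ : ∀ {n} (i j : Fin n) → inject₁ i < inject₁ j ⇔ i < j
inject₁-<⇔ i j = mk⇔ (subst₂ ℕ._<_ (toℕ-inject₁ i) (toℕ-inject₁ j))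
                     (subst₂ ℕ._<_ (sym (toℕ-inject₁ i)) (sym (toℕ-inject₁ j)))

inject₁<fromℕ : ∀ {n} (i : Fin n) → inject₁ i < fromℕ n
inject₁<fromℕ zero    = s≤s z≤n
inject₁<fromℕ (suc i) = s≤s (inject₁<fromℕ i)

≢0,2⇒≡1 : ∀ x → ¬ (x ≡ l0) → ¬ (x ≡ l2) → x ≡ l1
≢0,2⇒≡1 l0 x≢0 _   = ⊥-elim (x≢0 refl)
≢0,2⇒≡1 l1 _   _   = refl
≢0,2⇒≡1 l2 _   x≢2 = ⊥-elim (x≢2 refl)

Tr-init : ∀ {m} (u : Word (suc m)) a → Tr (suc (suc m)) (u ∷ʳ a) → Tr (suc m) u
Tr-init (x ∷ u) a t = record { firstNot2 = first ; no01 = pattern01 }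
  where
  open Tr t
  first : (i : Fin (suc _)) → toℕ i ≡ 0 → ¬ (lookup (x ∷ u) i ≡ l2)
  first zero _ = firstNot2 zero refl
  pattern01 : (i j : Fin (suc _)) → i < j → lookup (x ∷ u) i ≡ l0 → ¬ (lookup (x ∷ u) j ≡ l1)
  pattern01 i j i<j
    rewrite sym (lookup-∷ʳ-inject₁ (x ∷ u) a i) | sym (lookup-∷ʳ-inject₁ (x ∷ u) a j) =
    no01 (inject₁ i) (inject₁ j) (Equivalence.from (inject₁-<⇔ i j) i<j)

Tr-last1 : ∀ {n} (u : Word n) → Tr (suc n) (u ∷ʳ l1) → OneTwo u
Tr-last1 {n} u t i ui≡0 =
  Tr.no01 t (inject₁ i) (fromℕ n) (inject₁<fromℕ i)
    (trans (lookup-∷ʳ-inject₁ u l1 i) ui≡0) (lookup-∷ʳ-fromℕ u l1)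

-- Backward half: appending a letter to a word of Tr creates no new
-- first letter and no new pattern 0…1, unless the letter is 1 and u has a 0.
Tr-snoc : ∀ {m} (u : Word (suc m)) a → Tr (suc m) u → (a ≡ l1 → OneTwo u)
  → Tr (suc (suc m)) (u ∷ʳ a)
Tr-snoc {m} (x ∷ u) a t a≡1⇒u12 = record { firstNot2 = first ; no01 = pattern01 }
  where
  open Tr t
  first : (i : Fin (suc (suc m))) → toℕ i ≡ 0 → ¬ (lookup ((x ∷ u) ∷ʳ a) i ≡ l2)
  first zero _ = firstNot2 zero refl
  pattern01 : (i j : Fin (suc (suc m))) → i < j
    → lookup ((x ∷ u) ∷ʳ a) i ≡ l0 → ¬ (lookup ((x ∷ u) ∷ʳ a) j ≡ l1)
  pattern01 i j i<j with view i | view j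
  ... | ‵inject₁ i′ | ‵inject₁ j′
    rewrite lookup-∷ʳ-inject₁ (x ∷ u) a i′ | lookup-∷ʳ-inject₁ (x ∷ u) a j′ =
    no01 i′ j′ (Equivalence.to (inject₁-<⇔ i′ j′) i<j)
  ... | ‵inject₁ i′ | ‵fromℕ
    rewrite lookup-∷ʳ-inject₁ (x ∷ u) a i′ | lookup-∷ʳ-fromℕ (x ∷ u) a =
    λ ui′≡0 a≡1 → a≡1⇒u12 a≡1 i′ ui′≡0
  ... | ‵fromℕ | ‵inject₁ j′ = ⊥-elim (<-asym i<j (inject₁<fromℕ j′))
  ... | ‵fromℕ | ‵fromℕ      = ⊥-elim (<-irrefl refl i<j)

Tr-∷ʳ : ∀ {m} (u : Word (suc m)) a
  → Tr (suc (suc m)) (u ∷ʳ a) ⇔ (Tr (suc m) u × (a ≡ l1 → OneTwo u))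
Tr-∷ʳ u a = mk⇔ (λ t → Tr-init u a t , λ { refl → Tr-last1 u t })
                (λ (t , a≡1⇒u12) → Tr-snoc u a t a≡1⇒u12)

Tr-over12 : ∀ {m} x (w : Word m) → OneTwo (x ∷ w) → Tr (suc m) (x ∷ w) ⇔ x ≡ l1
Tr-over12 {m} x w xw12 = mk⇔ starts1 inTr
  where
  starts1 : Tr (suc m) (x ∷ w) → x ≡ l1
  starts1 t = ≢0,2⇒≡1 x (xw12 zero) (Tr.firstNot2 t zero refl)
  inTr : x ≡ l1 → Tr (suc m) (x ∷ w)
  inTr refl = record { firstNot2 = first ; no01 = λ i _ _ ui≡0 _ → xw12 i ui≡0 }
    where
    first : (i : Fin (suc m)) → toℕ i ≡ 0 → ¬ (lookup (l1 ∷ w) i ≡ l2)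
    first zero _ ()

≼-∷ʳ : ∀ {n} (u u′ : Word n) a b → (u ∷ʳ a) ≼ (u′ ∷ʳ b) ⇔ (u ≼ u′ × a ≤L b)
≼-∷ʳ {n} u u′ a b = mk⇔ split join
  where
  split : (u ∷ʳ a) ≼ (u′ ∷ʳ b) → u ≼ u′ × a ≤L b
  split ua≼u′b =
      (λ i → subst₂ _≤L_ (lookup-∷ʳ-inject₁ u a i) (lookup-∷ʳ-inject₁ u′ b i) (ua≼u′b (inject₁ i)))
    , subst₂ _≤L_ (lookup-∷ʳ-fromℕ u a) (lookup-∷ʳ-fromℕ u′ b) (ua≼u′b (fromℕ n))
  join : u ≼ u′ × a ≤L b → (u ∷ʳ a) ≼ (u′ ∷ʳ b)
  join (u≼u′ , a≤b) k with view k
  ... | ‵inject₁ i =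
    subst₂ _≤L_ (sym (lookup-∷ʳ-inject₁ u a i)) (sym (lookup-∷ʳ-inject₁ u′ b i)) (u≼u′ i)
  ... | ‵fromℕ =
    subst₂ _≤L_ (sym (lookup-∷ʳ-fromℕ u a)) (sym (lookup-∷ʳ-fromℕ u′ b)) a≤b

TrFamilies : (m : ℕ) → Word (suc (suc m)) → Set
TrFamilies m v =
  (Σ (Word (suc m)) λ u → Tr (suc m) u × v ≡ u ∷ʳ l0)
  ⊎ (Σ (Word (suc m)) λ u → Tr (suc m) u × v ≡ u ∷ʳ l2)
  ⊎ (Σ (Word m) λ w → OneTwo w × v ≡ (l1 ∷ w) ∷ʳ l1)

Tr-families : (m : ℕ) (v : Word (suc (suc m))) → Tr (suc (suc m)) v ⇔ TrFamilies m v
Tr-families m v = mk⇔ decompose compose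
  where
  decompose : Tr (suc (suc m)) v → TrFamilies m v
  decompose t with initLast v
  ... | u , l0 , refl = inj₁ (u , proj₁ (Equivalence.to (Tr-∷ʳ u l0) t) , refl)
  ... | u , l2 , refl = inj₂ (inj₁ (u , proj₁ (Equivalence.to (Tr-∷ʳ u l2) t) , refl))
  ... | x ∷ w , l1 , refl
    with xw∈Tr , xw12 ← Equivalence.to (Tr-∷ʳ (x ∷ w) l1) t
    with refl ← Equivalence.to (Tr-over12 x w (xw12 refl)) xw∈Tr
    = inj₂ (inj₂ (w , (λ i → xw12 refl (suc i)) , refl))
  compose : TrFamilies m v → Tr (suc (suc m)) v
  compose (inj₁ (u , u∈Tr , refl))       = Equivalence.from (Tr-∷ʳ u l0) (u∈Tr , λ ())
  compose (inj₂ (inj₁ (u , u∈Tr , refl))) = Equivalence.from (Tr-∷ʳ u l2) (u∈Tr , λ ())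
  compose (inj₂ (inj₂ (w , w12 , refl))) =
    Equivalence.from (Tr-∷ʳ (l1 ∷ w) l1)
      (Equivalence.from (Tr-over12 l1 w 1w12) refl , λ _ → 1w12)
    where
    1w12 : OneTwo (l1 ∷ w)
    1w12 zero    = λ ()
    1w12 (suc i) = w12 i

lemma2p2 : (m : ℕ)
    → ((v : Word (suc (suc m)))
        → Tr (suc (suc m)) v
          ⇔ ((Σ (Word (suc m)) λ u → Tr (suc m) u × v ≡ u ∷ʳ l0)
            ⊎ (Σ (Word (suc m)) λ u → Tr (suc m) u × v ≡ u ∷ʳ l2)
            ⊎ (Σ (Word m) λ w → OneTwo w × v ≡ (l1 ∷ w) ∷ʳ l1)))
      × ((u u′ : Word (suc m)) → (a b : Letter)
        → ((u ∷ʳ a) ≼ (u′ ∷ʳ b)) ⇔ (u ≼ u′ × a ≤L b))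
lemma2p2 m = Tr-families m , ≼-∷ʳ
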